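{- Let $S$ be a subdivided star and let $S'$ be obtained from $S$ by attaching a path $P_3$ (joining one endpoint of a new path on $3$ vertices by an edge) either to a leaf of $S$ or to the central vertex of $S$. Then in the game $\mathbf{0.33}$, $\mathcal{G}(S')=\mathcal{G}(S)$.
   Context: The game $\mathbf{0.33}$ on a finite graph $G$: players alternate; a move chooses a set $X$ of one vertex or of two adjacent vertices of $G$, lying in a connected component $H$ of $G$, such that $H-X$ is empty or connected, and deletes $X$. A player unable to move loses (normal play). Grundy value: $\mathcal{G}(G)=\mathrm{mex}\{\mathcal{G}(G'): G' \text{ reachable in one move}\}$. Subdivided star $S_{\ell_1,\ldots,\ell_k}$ ($k\ge0$, $\ell_i\ge1$): a central vertex $c$ with $k$ vertex-disjoint paths of $\ell_1,\ldots,\ell_k$ vertices each having one endpoint adjacent to $c$ (a single vertex if $k=0$). Attaching $P_3$ at the leaf end of the $i$-th path gives $S_{\ell_1,\ldots,\ell_i+3,\ldots,\ell_k}$; attaching it at the center gives $S_{\ell_1,\ldots,\ell_k,3}$. -}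

module Defs where

open import Data.Nat using (ℕ; zero; suc; _<_; _≤_; _+_)
open import Data.Fin using (Fin; zero; suc; toℕ)
open import Data.Fin.Properties using () renaming (_≟_ to _≟F_)
open import Data.Bool using (Bool; true; false; _∧_; not; T)
open import Data.Product using (Σ; _×_; _,_)
open import Data.Product.Properties using (≡-dec)
open import Data.Sum using (_⊎_)
open import Data.Empty using (⊥)
open import Data.Unit using (⊤)
open import Relation.Nullary using (¬_; does)
open import Relation.Binary.Definitions using (DecidableEquality)
open import Relation.Binary.PropositionalEquality using (_≡_; _≢_; refl)
open import Data.Vec.Functional using (Vector; tail)

record Graph : Set₁ where
  field
    V      : Set
    _≟_    : DecidableEquality V
    Adj    : V → V → Set
    sym    : ∀ {u v} → Adj u v → Adj v u
    irrefl : ∀ {v} → ¬ Adj v v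

-- A game position is the subgraph of G induced by a set of "alive"
-- vertices (V → Bool).  Grundy values are invariant under isomorphism,
-- so working with induced subgraphs of the starting graph is faithful.

module _ (G : Graph) where
  open Graph G

  VSet : Set
  VSet = V → Bool

  full : VSet
  full _ = true

  _─_ : VSet → VSet → VSet
  (A ─ X) v = A v ∧ not (X v)

  single : V → VSet
  single x v = does (x ≟ v)

  pair : V → V → VSet
  pair x y v = does (x ≟ v) Data.Bool.∨ does (y ≟ v)

  data Reach (A : VSet) (u : V) : V → Set where
    here : T (A u) → Reach A u u
    step : ∀ {w v} → Reach A u w → Adj w v → T (A v) → Reach A u v

  -- Deleting X (containing x) from the position A: writing H for the
  -- connected component of x in A, H - X must be empty or connected,
  -- i.e. any two remaining vertices of H are joined by a path in H - X
  -- (equivalently in A - X).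
  ComponentStaysConnected : VSet → VSet → V → Set
  ComponentStaysConnected A X x =
    ∀ v w → T ((A ─ X) v) → T ((A ─ X) w) →
      Reach A x v → Reach A x w → Reach (A ─ X) v w

  data Move (A : VSet) : Set where
    one : (x : V) → T (A x) →
          ComponentStaysConnected A (single x) x → Move A
    two : (x y : V) → T (A x) → T (A y) → Adj x y →
          ComponentStaysConnected A (pair x y) x → Move A

  result : {A : VSet} → Move A → VSet
  result {A} (one x _ _)         = A ─ (single x)
  result {A} (two x y _ _ _ _)   = A ─ (pair x y)

  -- HasGrundy A g : the position A has Grundy value g, i.e.
  -- g = mex { Grundy values of options }: no option has value g, and
  -- every h < g is the value of some option.
  data HasGrundy : VSet → ℕ → Set where
    grundy : ∀ {A g} →
      ((m : Move A) → Σ ℕ λ h → h ≢ g × HasGrundy (result m) h) →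
      ((h : ℕ) → h < g → Σ (Move A) λ m → HasGrundy (result m) h) →
      HasGrundy A g

GrundyValue : (G : Graph) → ℕ → Set
GrundyValue G g = HasGrundy G (full G) g

SameGrundy : Graph → Graph → Set
SameGrundy G H = Σ ℕ λ g → GrundyValue G g × GrundyValue H g

-- Subdivided stars S_{ℓ_1,…,ℓ_k}: centre c plus, for each i, a path
-- (i,0)-(i,1)-…-(i,ℓ_i - 1) with (i,0) adjacent to c.

data StarV (k : ℕ) (ℓ : Fin k → ℕ) : Set where
  centre : StarV k ℓ
  node   : (i : Fin k) → Fin (ℓ i) → StarV k ℓ

data StarAdj {k : ℕ} {ℓ : Fin k → ℕ} : StarV k ℓ → StarV k ℓ → Set where
  c-n  : ∀ {i} (j : Fin (ℓ i)) → toℕ j ≡ 0 → StarAdj centre (node i j)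
  n-c  : ∀ {i} (j : Fin (ℓ i)) → toℕ j ≡ 0 → StarAdj (node i j) centre
  n-n  : ∀ {i} (j j' : Fin (ℓ i)) → toℕ j' ≡ suc (toℕ j) →
         StarAdj (node i j) (node i j')
  n-n' : ∀ {i} (j j' : Fin (ℓ i)) → toℕ j ≡ suc (toℕ j') →
         StarAdj (node i j) (node i j')

private
  n-inj₁ : ∀ {k ℓ i i' j j'} → node {k} {ℓ} i j ≡ node i' j' → i ≡ i'
  n-inj₁ refl = refl

  n-inj₂ : ∀ {k ℓ i j j'} → node {k} {ℓ} i j ≡ node i j' → j ≡ j'
  n-inj₂ refl = refl

  suc-neq : ∀ {n : ℕ} → n ≢ suc n
  suc-neq ()

starV-≟ : ∀ {k ℓ} → DecidableEquality (StarV k ℓ)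
starV-≟ centre centre = Relation.Nullary.yes refl
starV-≟ centre (node _ _) = Relation.Nullary.no λ ()
starV-≟ (node _ _) centre = Relation.Nullary.no λ ()
starV-≟ (node i j) (node i' j') with i ≟F i'
... | Relation.Nullary.no ne = Relation.Nullary.no λ e → ne (n-inj₁ e)
starV-≟ (node i j) (node .i j') | Relation.Nullary.yes refl with j ≟F j'
... | Relation.Nullary.yes refl = Relation.Nullary.yes refl
... | Relation.Nullary.no ne = Relation.Nullary.no λ e → ne (n-inj₂ e)

starAdj-sym : ∀ {k ℓ} {u v : StarV k ℓ} → StarAdj u v → StarAdj v u
starAdj-sym (c-n j e) = n-c j e
starAdj-sym (n-c j e) = c-n j e
starAdj-sym (n-n j j' e) = n-n' j' j e
starAdj-sym (n-n' j j' e) = n-n j' j e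

starAdj-irrefl : ∀ {k ℓ} {v : StarV k ℓ} → ¬ StarAdj v v
starAdj-irrefl (n-n j .j e) = suc-neq e
starAdj-irrefl (n-n' j .j e) = suc-neq e

Star : (k : ℕ) → (Fin k → ℕ) → Graph
Star k ℓ = record
  { V = StarV k ℓ ; _≟_ = starV-≟ ; Adj = StarAdj
  ; sym = starAdj-sym ; irrefl = starAdj-irrefl }

snoc : ∀ {k} → (Fin k → ℕ) → ℕ → Fin (suc k) → ℕ
snoc {zero}  ℓ x zero    = x
snoc {suc k} ℓ x zero    = ℓ zero
snoc {suc k} ℓ x (suc i) = snoc (tail ℓ) x i

module Submission where

-- Every position reachable in 0.33 from a subdivided star is empty, a path lying on one
-- leg, or a sub-star S_a (centre alive, leg lengths a ≤ ℓ): as a move must leave the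
-- component connected, it either shortens a leg at its end, or deletes the centre
-- (possibly with a neighbour) when at most one leg then remains. A path P_n is the
-- subtraction game {1, 2}, with value n mod 3. For sub-stars, induction on the total
-- length shows that the value is starValue n₁ n₂, where n_r counts the legs of length
-- ≡ r (mod 3); shortening a leg moves (n₁, n₂) to a neighbouring entry of the table,
-- and the two table facts the induction needs (neighbouring entries differ, every
-- smaller value is reached by some move) are finite checks because the table is
-- eventually 2-periodic in both arguments. Attaching P₃ at a leaf or at the centre
-- leaves n₁ and n₂ unchanged.

open import Defs
open import Data.Nat using (ℕ; zero; suc; pred; _+_; _∸_; _≤_; _<_; z≤n; s≤s; _≟_; _<?_; _≡ᵇ_; _<ᵇ_)
open import Data.Nat.Properties
open import Data.Nat.Induction using (<-rec; <-wellFounded)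
open import Data.Nat.Tactic.RingSolver using (solve-∀)
open import Data.Fin using (Fin; zero; suc; toℕ; fromℕ<; #_)
open import Data.Fin.Properties using (all?; any?; toℕ-fromℕ<; toℕ-injective; toℕ<n)
import Data.Fin.Properties as Fin
open import Data.Vec using (Vec; []; _∷_; lookup)
open import Data.Vec.Functional using (Vector; updateAt; tail)
open import Data.Vec.Functional.Properties using (updateAt-updates; updateAt-minimal)
open import Data.Bool using (Bool; true; false; not; _∧_; T; if_then_else_)
open import Data.Bool.Properties using (T?; T-∧)
open import Data.Unit using (⊤; tt)
open import Data.Empty using (⊥; ⊥-elim)
open import Data.Product using (Σ; _×_; _,_; proj₁; proj₂)
open import Data.Sum using (_⊎_; inj₁; inj₂; swap)
open import Function using (const)
open import Function.Bundles using (_⇔_; mk⇔; Equivalence)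
import Function.Properties.Equivalence as ⇔
open import Induction.WellFounded using (module All)
open import Level using (0ℓ)
open import Relation.Nullary using (¬_; ¬?; Dec; yes; no)
open import Relation.Nullary.Decidable using (True; toWitness; _×-dec_; _⊎-dec_)
open import Relation.Unary using (Pred; ∅; ｛_｝; _∪_; _∩_; ∁)
open import Relation.Binary.PropositionalEquality
  using (_≡_; _≢_; ≢-sym; refl; subst; sym; trans; cong; cong₂; module ≡-Reasoning)
import Relation.Binary.Construct.On as On
open Equivalence using (to; from)

eventually2Periodic : (Q : ℕ → Set) (p : ℕ) →
  (∀ n → Q (p + n) → Q (p + suc (suc n))) → (∀ n → n < 2 + p → Q n) → ∀ n → Q n
eventually2Periodic Q p shift small n with ≤-total p n
... | inj₁ p≤n = subst Q (m+[n∸m]≡n p≤n) (fromOffset _)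
  where
    fromOffset : ∀ m → Q (p + m)
    fromOffset zero = small _ (≤-<-trans (≤-reflexive (+-identityʳ p)) (m<n+m p (s≤s z≤n)))
    fromOffset (suc zero) = small _ (≤-reflexive (cong suc (+-comm p 1)))
    fromOffset (suc (suc m)) = shift m (fromOffset m)
... | inj₂ n≤p = small n (s≤s (m≤n⇒m≤1+n n≤p))

finCheck⇒below : ∀ {n} (Q : ℕ → Set) → ((i : Fin n) → Q (toℕ i)) → ∀ m → m < n → Q m
finCheck⇒below Q q m m<n = subst Q (toℕ-fromℕ< m<n) (q (fromℕ< m<n))

eventually2Periodic² : (D : ℕ → ℕ → Set) (p q : ℕ) →
  (∀ n b → D (p + n) b → D (p + suc (suc n)) b) →
  (∀ a n → D a (q + n) → D a (q + suc (suc n))) →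
  ((a : Fin (2 + p)) (b : Fin (2 + q)) → D (toℕ a) (toℕ b)) → ∀ a b → D a b
eventually2Periodic² D p q shift₁ shift₂ table =
  eventually2Periodic (λ a → ∀ b → D a b) p (λ n h b → shift₁ n b (h b)) λ a a<2+p →
    eventually2Periodic (D a) q (shift₂ a)
      (finCheck⇒below (D a) λ b → finCheck⇒below (λ a → D a (toℕ b)) (λ a → table a b) a a<2+p)

period₁ : ℕ → Fin 4
period₁ 0 = # 0
period₁ 1 = # 1
period₁ 2 = # 2
period₁ 3 = # 3
period₁ (suc (suc (suc (suc n)))) = period₁ (suc (suc n))

period₂ : ℕ → Fin 6
period₂ 0 = # 0
period₂ 1 = # 1
period₂ 2 = # 2
period₂ 3 = # 3
period₂ 4 = # 4
period₂ 5 = # 5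
period₂ (suc (suc (suc (suc (suc (suc n)))))) = period₂ (suc (suc (suc (suc n))))

-- Row n₂, column n₁, where n_r is the number of legs of length ≡ r (mod 3).
valueTable : Vec (Vec ℕ 4) 6
valueTable = (1 ∷ 2 ∷ 0 ∷ 1 ∷ [])
           ∷ (0 ∷ 1 ∷ 2 ∷ 3 ∷ [])
           ∷ (2 ∷ 0 ∷ 1 ∷ 0 ∷ [])
           ∷ (1 ∷ 2 ∷ 3 ∷ 2 ∷ [])
           ∷ (0 ∷ 1 ∷ 0 ∷ 1 ∷ [])
           ∷ (2 ∷ 3 ∷ 2 ∷ 3 ∷ [])
           ∷ []

starValue : ℕ → ℕ → ℕ
starValue n₁ n₂ = lookup (lookup valueTable (period₂ n₂)) (period₁ n₁)

NeighboursDistinct : ℕ → ℕ → Set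
NeighboursDistinct a b =
  starValue a b ≢ starValue (suc a) b × starValue a b ≢ starValue a (suc b) ×
  starValue a (suc b) ≢ starValue (suc a) b

-- The shift hypotheses hold by computation: period₁ and period₂ make starValue
-- definitionally 2-periodic beyond the table.
neighboursDistinct : ∀ a b → NeighboursDistinct a b
neighboursDistinct = eventually2Periodic² NeighboursDistinct 2 4 (λ _ _ h → h) (λ _ _ h → h)
  (toWitness {a? = all? λ a → all? λ b → ¬? (_ ≟ _) ×-dec ¬? (_ ≟ _) ×-dec ¬? (_ ≟ _)} _)

-- How a star with n₀ positive legs ≡ 0, n₁ legs ≡ 1 and n₂ legs ≡ 2 (mod 3) reaches value h:
-- value 0 when n₀ = n₂ = 0 and n₁ ≤ 1, or by shortening a leg of some class by 1 or 2.
LowerOption : ℕ → ℕ → ℕ → ℕ → Set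
LowerOption n₀ n₁ n₂ h =
     T ((n₀ ≡ᵇ 0) ∧ (n₂ ≡ᵇ 0) ∧ (n₁ <ᵇ 2)) × 0 ≡ h
  ⊎ T (0 <ᵇ n₁) × starValue (pred n₁) n₂ ≡ h
  ⊎ T (0 <ᵇ n₂) × starValue (suc n₁) (pred n₂) ≡ h
  ⊎ T (0 <ᵇ n₂) × starValue n₁ (pred n₂) ≡ h
  ⊎ T (0 <ᵇ n₀) × starValue n₁ (suc n₂) ≡ h
  ⊎ T (0 <ᵇ n₀) × starValue (suc n₁) n₂ ≡ h

pattern clearStar t e       = inj₁ (t , e)
pattern shortenOne₁ t e     = inj₂ (inj₁ (t , e))
pattern shortenTwo₁ t e     = inj₂ (inj₂ (inj₁ (t , e)))
pattern shortenTwo₂ t e     = inj₂ (inj₂ (inj₂ (inj₁ (t , e))))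
pattern shortenZero₁ t e    = inj₂ (inj₂ (inj₂ (inj₂ (inj₁ (t , e)))))
pattern shortenZero₂ t e    = inj₂ (inj₂ (inj₂ (inj₂ (inj₂ (t , e)))))

LowerValuesCovered : ℕ → ℕ → ℕ → Set
LowerValuesCovered n₀ n₁ n₂ = (h : Fin (starValue n₁ n₂)) → LowerOption n₀ n₁ n₂ (toℕ h)

lowerValuesCovered : ∀ n₀ n₁ n₂ h → h < starValue n₁ n₂ → LowerOption n₀ n₁ n₂ h
lowerValuesCovered n₀ n₁ n₂ = finCheck⇒below (LowerOption n₀ n₁ n₂) (covered n₀ n₁ n₂)
  where
    table? : ∀ n₀ → Dec ((a : Fin 5) (b : Fin 7) → LowerValuesCovered n₀ (toℕ a) (toℕ b))
    table? n₀ = all? λ a → all? λ b → all? λ h →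
      (T? _ ×-dec (_ ≟ _)) ⊎-dec (T? _ ×-dec (_ ≟ _)) ⊎-dec (T? _ ×-dec (_ ≟ _)) ⊎-dec
      (T? _ ×-dec (_ ≟ _)) ⊎-dec (T? _ ×-dec (_ ≟ _)) ⊎-dec (T? _ ×-dec (_ ≟ _))
    fromTable : ∀ n₀ → True (table? n₀) → ∀ n₁ n₂ → LowerValuesCovered n₀ n₁ n₂
    fromTable n₀ ok = eventually2Periodic² (LowerValuesCovered n₀) 3 5 (λ _ _ h → h) (λ _ _ h → h) (toWitness ok)
    -- only whether n₀ vanishes matters
    covered : ∀ n₀ n₁ n₂ → LowerValuesCovered n₀ n₁ n₂
    covered zero = fromTable 0 _
    covered (suc n₀) = fromTable 1 _

mod3 : ℕ → ℕ
mod3 (suc (suc (suc n))) = mod3 n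
mod3 n = n

mod3<3 : ∀ n → mod3 n < 3
mod3<3 0 = s≤s z≤n
mod3<3 1 = s≤s (s≤s z≤n)
mod3<3 2 = s≤s (s≤s (s≤s z≤n))
mod3<3 (suc (suc (suc n))) = mod3<3 n

mod3-+3 : ∀ n → mod3 (n + 3) ≡ mod3 n
mod3-+3 n rewrite +-comm n 3 = refl

mod3-suc≢ : ∀ n → mod3 (suc n) ≢ mod3 n
mod3-suc≢ 0 ()
mod3-suc≢ 1 ()
mod3-suc≢ 2 ()
mod3-suc≢ (suc (suc (suc n))) = mod3-suc≢ n

mod3-2+≢ : ∀ n → mod3 (suc (suc n)) ≢ mod3 n
mod3-2+≢ 0 ()
mod3-2+≢ 1 ()
mod3-2+≢ 2 ()
mod3-2+≢ (suc (suc (suc n))) = mod3-2+≢ n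

Shortens : ℕ → ℕ → Set
Shortens n m = n ≡ suc m ⊎ n ≡ suc (suc m)

shortens⇒< : ∀ {n m} → Shortens n m → m < n
shortens⇒< (inj₁ refl) = n<1+n _
shortens⇒< (inj₂ refl) = m<n⇒m<1+n (n<1+n _)

<2⇒≡0⊎≡1 : ∀ {n} → n < 2 → n ≡ 0 ⊎ n ≡ 1
<2⇒≡0⊎≡1 (s≤s z≤n) = inj₁ refl
<2⇒≡0⊎≡1 (s≤s (s≤s z≤n)) = inj₂ refl

mod3-shortens≢ : ∀ {n m} → Shortens n m → mod3 m ≢ mod3 n
mod3-shortens≢ {m = m} (inj₁ refl) e = mod3-suc≢ m (sym e)
mod3-shortens≢ {m = m} (inj₂ refl) e = mod3-2+≢ m (sym e)

mod3-below : ∀ n h → h < mod3 n → Σ ℕ λ m → Shortens n m × h ≡ mod3 m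
mod3-below 1 0 _ = 0 , inj₁ refl , refl
mod3-below 2 0 _ = 0 , inj₂ refl , refl
mod3-below 2 1 _ = 1 , inj₁ refl , refl
mod3-below 1 (suc h) (s≤s ())
mod3-below 2 (suc (suc h)) (s≤s (s≤s ()))
mod3-below (suc (suc (suc n))) h h<
  with mod3-below n h h<
... | m , inj₁ refl , e = suc (suc (suc m)) , inj₁ refl , e
... | m , inj₂ refl , e = suc (suc (suc m)) , inj₂ refl , e

oneMod3 twoMod3 zeroMod3⁺ : ℕ → Bool
oneMod3 n = mod3 n ≡ᵇ 1
twoMod3 n = mod3 n ≡ᵇ 2
zeroMod3⁺ zero = false
zeroMod3⁺ (suc n) = mod3 (suc n) ≡ᵇ 0

residueClass : ∀ n → n ≡ 0 ⊎ T (zeroMod3⁺ n) ⊎ T (oneMod3 n) ⊎ T (twoMod3 n)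
residueClass 0 = inj₁ refl
residueClass 1 = inj₂ (inj₂ (inj₁ tt))
residueClass 2 = inj₂ (inj₂ (inj₂ tt))
residueClass 3 = inj₂ (inj₁ tt)
residueClass (suc (suc (suc (suc n)))) with residueClass (suc n)
... | inj₂ c = inj₂ c

oneMod3-pred : ∀ u → T (oneMod3 u) → Σ ℕ λ v → u ≡ suc v × mod3 v ≡ 0
oneMod3-pred 1 _ = 0 , refl , refl
oneMod3-pred (suc (suc (suc u))) t with oneMod3-pred u t
... | v , refl , e = suc (suc (suc v)) , refl , e

oneMod3-split : ∀ u → T (oneMod3 u) → u ≡ 1 ⊎ Σ ℕ λ v → u ≡ suc (suc v) × mod3 v ≡ 2
oneMod3-split 1 _ = inj₁ refl
oneMod3-split (suc (suc (suc u))) t with oneMod3-split u t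
... | inj₁ refl = inj₂ (2 , refl , refl)
... | inj₂ (v , refl , e) = inj₂ (suc (suc (suc v)) , refl , e)

twoMod3-pred : ∀ u → T (twoMod3 u) → Σ ℕ λ v → u ≡ suc v × mod3 v ≡ 1
twoMod3-pred 2 _ = 1 , refl , refl
twoMod3-pred (suc (suc (suc u))) t with twoMod3-pred u t
... | v , refl , e = suc (suc (suc v)) , refl , e

twoMod3-pred² : ∀ u → T (twoMod3 u) → Σ ℕ λ v → u ≡ suc (suc v) × mod3 v ≡ 0
twoMod3-pred² 2 _ = 0 , refl , refl
twoMod3-pred² (suc (suc (suc u))) t with twoMod3-pred² u t
... | v , refl , e = suc (suc (suc v)) , refl , e

zeroMod3⁺-pred : ∀ u → T (zeroMod3⁺ u) → Σ ℕ λ v → u ≡ suc v × mod3 v ≡ 2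
zeroMod3⁺-pred 3 _ = 2 , refl , refl
zeroMod3⁺-pred (suc (suc (suc (suc u)))) t with zeroMod3⁺-pred (suc u) t
... | v , refl , e = suc (suc (suc v)) , refl , e

zeroMod3⁺-pred² : ∀ u → T (zeroMod3⁺ u) → Σ ℕ λ v → u ≡ suc (suc v) × mod3 v ≡ 1
zeroMod3⁺-pred² 3 _ = 1 , refl , refl
zeroMod3⁺-pred² (suc (suc (suc (suc u)))) t with zeroMod3⁺-pred² (suc u) t
... | v , refl , e = suc (suc (suc v)) , refl , e

zeroMod3⁺⇒ : ∀ u → T (zeroMod3⁺ u) → mod3 u ≡ 0
zeroMod3⁺⇒ (suc u) t = ≡ᵇ⇒≡ (mod3 (suc u)) 0 t

indicator : Bool → ℕ
indicator b = if b then 1 else 0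

sumOf : ∀ {k} → (ℕ → ℕ) → Vector ℕ k → ℕ
sumOf {zero} g a = 0
sumOf {suc k} g a = g (a zero) + sumOf g (tail a)

count : ∀ {k} → (ℕ → Bool) → Vector ℕ k → ℕ
count p = sumOf (λ n → indicator (p n))

sumOf-updateAt : ∀ {k} g (a : Vector ℕ k) i f →
                 sumOf g (updateAt a i f) + g (a i) ≡ sumOf g a + g (f (a i))
sumOf-updateAt g a zero f = exchange (g (f (a zero))) (sumOf g (tail a)) (g (a zero))
  where
    exchange : ∀ x y z → x + y + z ≡ z + y + x
    exchange = solve-∀
sumOf-updateAt g a (suc i) f = begin
  g (a zero) + sumOf g (updateAt (tail a) i f) + g (a (suc i))
    ≡⟨ +-assoc (g (a zero)) _ _ ⟩
  g (a zero) + (sumOf g (updateAt (tail a) i f) + g (a (suc i)))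
    ≡⟨ cong (g (a zero) +_) (sumOf-updateAt g (tail a) i f) ⟩
  g (a zero) + (sumOf g (tail a) + g (f (a (suc i))))
    ≡⟨ +-assoc (g (a zero)) _ _ ⟨
  g (a zero) + sumOf g (tail a) + g (f (a (suc i))) ∎
  where open ≡-Reasoning

sumOf-snoc : ∀ {k} g (a : Vector ℕ k) x → sumOf g (snoc a x) ≡ sumOf g a + g x
sumOf-snoc {zero} g a x = +-identityʳ (g x)
sumOf-snoc {suc k} g a x =
  trans (cong (g (a zero) +_) (sumOf-snoc g (tail a) x)) (sym (+-assoc (g (a zero)) _ _))

sumOf-zero : ∀ {k} g (a : Vector ℕ k) → (∀ j → g (a j) ≡ 0) → sumOf g a ≡ 0
sumOf-zero {zero} g a z = refl
sumOf-zero {suc k} g a z = cong₂ _+_ (z zero) (sumOf-zero g (tail a) (λ j → z (suc j)))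

sumOf-zero⁻¹ : ∀ {k} g (a : Vector ℕ k) → sumOf g a ≡ 0 → ∀ j → g (a j) ≡ 0
sumOf-zero⁻¹ {suc k} g a e zero = m+n≡0⇒m≡0 (g (a zero)) e
sumOf-zero⁻¹ {suc k} g a e (suc j) = sumOf-zero⁻¹ g (tail a) (m+n≡0⇒n≡0 (g (a zero)) e) j

sumOf-pos : ∀ {k} g (a : Vector ℕ k) → 0 < sumOf g a → Σ (Fin k) λ j → 0 < g (a j)
sumOf-pos {zero} g a ()
sumOf-pos {suc k} g a pos with g (a zero) in e
... | suc _ = zero , ≤-trans (s≤s z≤n) (≤-reflexive (sym e))
... | zero with sumOf-pos g (tail a) pos
...   | j , pos-j = suc j , pos-j

_[_]≔_ : ∀ {k} → Vector ℕ k → Fin k → ℕ → Vector ℕ k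
a [ i ]≔ v = updateAt a i (const v)

[]≔-cleared : ∀ {k} (a : Vector ℕ k) i → (∀ j → j ≢ i → a j ≡ 0) → ∀ j → (a [ i ]≔ 0) j ≡ 0
[]≔-cleared a i others j with j Fin.≟ i
... | yes refl = updateAt-updates i a
... | no j≢i = trans (updateAt-minimal j i a j≢i) (others j j≢i)

sumOf-single : ∀ {k} g (a : Vector ℕ k) i → g 0 ≡ 0 → (∀ j → j ≢ i → a j ≡ 0) → sumOf g a ≡ g (a i)
sumOf-single g a i g0 others = begin
  sumOf g a                          ≡⟨ +-identityʳ _ ⟨
  sumOf g a + 0                      ≡⟨ cong (sumOf g a +_) g0 ⟨
  sumOf g a + g 0                    ≡⟨ sumOf-updateAt g a i (const 0) ⟨
  sumOf g (a [ i ]≔ 0) + g (a i)     ≡⟨ cong (_+ g (a i)) (sumOf-zero g _ λ j → trans (cong g ([]≔-cleared a i others j)) g0) ⟩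
  g (a i)                            ∎
  where open ≡-Reasoning

zeroLegs oneLegs twoLegs : ∀ {k} → Vector ℕ k → ℕ
zeroLegs = count zeroMod3⁺
oneLegs = count oneMod3
twoLegs = count twoMod3

starValueOf : ∀ {k} → Vector ℕ k → ℕ
starValueOf a = starValue (oneLegs a) (twoLegs a)

count-zero⁻¹ : ∀ {k} p (a : Vector ℕ k) → count p a ≡ 0 → ∀ j → ¬ T (p (a j))
count-zero⁻¹ p a e j t with p (a j) | sumOf-zero⁻¹ _ a e j
... | true | ()

count-pos : ∀ {k} p (a : Vector ℕ k) → 0 < count p a → Σ (Fin k) λ j → T (p (a j))
count-pos p a pos with sumOf-pos _ a pos
... | j , pos-j = j , indicator-pos (p (a j)) pos-j
  where
    indicator-pos : ∀ b → 0 < indicator b → T b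
    indicator-pos true _ = tt

count-decreases : ∀ {y x} → y + 1 ≡ x + 0 → x ≡ suc y
count-decreases {y} {x} e = trans (sym (+-identityʳ x)) (trans (sym e) (+-comm y 1))

count-increases : ∀ {y x} → y + 0 ≡ x + 1 → y ≡ suc x
count-increases e = count-decreases (sym e)

count-unchanged : ∀ {y x} → y + 0 ≡ x + 0 → y ≡ x
count-unchanged {y} {x} e = trans (sym (+-identityʳ y)) (trans e (+-identityʳ x))

legCounts-[]≔ : ∀ {k} (a : Vector ℕ k) i v {s r} → mod3 (a i) ≡ s → mod3 v ≡ r →
  oneLegs (a [ i ]≔ v) + indicator (s ≡ᵇ 1) ≡ oneLegs a + indicator (r ≡ᵇ 1) ×
  twoLegs (a [ i ]≔ v) + indicator (s ≡ᵇ 2) ≡ twoLegs a + indicator (r ≡ᵇ 2)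
legCounts-[]≔ a i v refl refl = sumOf-updateAt _ a i (const v) , sumOf-updateAt _ a i (const v)

-- One leg moves from residue s to residue r; the counts are x before and y after.
starValue-changes : ∀ {y₁ y₂ x₁ x₂} r s → r < 3 → s < 3 → r ≢ s →
  y₁ + indicator (s ≡ᵇ 1) ≡ x₁ + indicator (r ≡ᵇ 1) →
  y₂ + indicator (s ≡ᵇ 2) ≡ x₂ + indicator (r ≡ᵇ 2) →
  starValue y₁ y₂ ≢ starValue x₁ x₂
starValue-changes {y₁} {y₂} {x₁} {x₂} 0 1 _ _ _ e₁ e₂ with count-decreases e₁ | count-unchanged e₂
... | refl | refl = proj₁ (neighboursDistinct y₁ y₂)
starValue-changes {y₁} {y₂} {x₁} {x₂} 0 2 _ _ _ e₁ e₂ with count-unchanged e₁ | count-decreases e₂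
... | refl | refl = proj₁ (proj₂ (neighboursDistinct y₁ y₂))
starValue-changes {y₁} {y₂} {x₁} {x₂} 1 0 _ _ _ e₁ e₂ with count-increases e₁ | count-unchanged e₂
... | refl | refl = ≢-sym (proj₁ (neighboursDistinct x₁ x₂))
starValue-changes {y₁} {y₂} {x₁} {x₂} 1 2 _ _ _ e₁ e₂ with count-increases e₁ | count-decreases e₂
... | refl | refl = ≢-sym (proj₂ (proj₂ (neighboursDistinct x₁ y₂)))
starValue-changes {y₁} {y₂} {x₁} {x₂} 2 0 _ _ _ e₁ e₂ with count-unchanged e₁ | count-increases e₂
... | refl | refl = ≢-sym (proj₁ (proj₂ (neighboursDistinct x₁ x₂)))
starValue-changes {y₁} {y₂} {x₁} {x₂} 2 1 _ _ _ e₁ e₂ with count-decreases e₁ | count-increases e₂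
... | refl | refl = proj₂ (proj₂ (neighboursDistinct y₁ x₂))
starValue-changes 0 0 _ _ r≢s = ⊥-elim (r≢s refl)
starValue-changes 1 1 _ _ r≢s = ⊥-elim (r≢s refl)
starValue-changes 2 2 _ _ r≢s = ⊥-elim (r≢s refl)
starValue-changes (suc (suc (suc _))) _ (s≤s (s≤s (s≤s ())))
starValue-changes _ (suc (suc (suc _))) _ (s≤s (s≤s (s≤s ())))

starValueOf-shortens : ∀ {k} (a : Vector ℕ k) i v → Shortens (a i) v → starValueOf (a [ i ]≔ v) ≢ starValueOf a
starValueOf-shortens a i v sh =
  starValue-changes (mod3 v) (mod3 (a i)) (mod3<3 v) (mod3<3 (a i)) (mod3-shortens≢ sh) e₁ e₂
  where
    e₁ = proj₁ (legCounts-[]≔ a i v refl refl)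
    e₂ = proj₂ (legCounts-[]≔ a i v refl refl)

totalLength : ∀ {k} → Vector ℕ k → ℕ
totalLength = sumOf (λ n → n)

totalLength-shortens : ∀ {k} (a : Vector ℕ k) i v → Shortens (a i) v → totalLength (a [ i ]≔ v) < totalLength a
totalLength-shortens a i v sh = +-cancelʳ-< (a i) _ _
  (subst (_< totalLength a + a i) (sym (sumOf-updateAt _ a i (const v))) (+-monoʳ-< (totalLength a) (shortens⇒< sh)))

noCountedLegs : ∀ {k} (a : Vector ℕ k) → zeroLegs a ≡ 0 → oneLegs a ≡ 0 → twoLegs a ≡ 0 → ∀ j → a j ≡ 0
noCountedLegs a z₀ z₁ z₂ j with residueClass (a j)
... | inj₁ e = e
... | inj₂ (inj₁ t) = ⊥-elim (count-zero⁻¹ zeroMod3⁺ a z₀ j t)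
... | inj₂ (inj₂ (inj₁ t)) = ⊥-elim (count-zero⁻¹ oneMod3 a z₁ j t)
... | inj₂ (inj₂ (inj₂ t)) = ⊥-elim (count-zero⁻¹ twoMod3 a z₂ j t)

onlyUnitLeg : ∀ {k} (a : Vector ℕ k) i → a i ≡ 1 →
              zeroLegs a ≡ 0 → oneLegs a ≡ 1 → twoLegs a ≡ 0 → ∀ j → j ≢ i → a j ≡ 0
onlyUnitLeg a i unit z₀ z₁ z₂ j j≢i =
  trans (sym (updateAt-minimal j i a j≢i))
        (noCountedLegs (a [ i ]≔ 0) (cleared zeroMod3⁺ refl z₀) unitRemoved (cleared twoMod3 refl z₂) j)
  where
    cleared : ∀ p → p 0 ≡ false → count p a ≡ 0 → count p (a [ i ]≔ 0) ≡ 0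
    cleared p p0 z = m+n≡0⇒m≡0 _ (trans (sumOf-updateAt _ a i (const 0)) (cong₂ _+_ z (cong indicator p0)))
    unitRemoved : oneLegs (a [ i ]≔ 0) ≡ 0
    unitRemoved = suc-injective (sym (count-decreases (begin
      oneLegs (a [ i ]≔ 0) + 1                            ≡⟨ cong (λ u → oneLegs (a [ i ]≔ 0) + indicator (oneMod3 u)) unit ⟨
      oneLegs (a [ i ]≔ 0) + indicator (oneMod3 (a i))    ≡⟨ sumOf-updateAt _ a i (const 0) ⟩
      oneLegs a + 0                                       ≡⟨ cong (_+ 0) z₁ ⟩
      1 + 0                                               ∎)))
      where open ≡-Reasoning

singleLegValue : ℕ → ℕ
singleLegValue u = starValue (indicator (oneMod3 u)) (indicator (twoMod3 u))

starValueOf-single : ∀ {k} (a : Vector ℕ k) i → (∀ j → j ≢ i → a j ≡ 0) → starValueOf a ≡ singleLegValue (a i)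
starValueOf-single a i others = cong₂ starValue (sumOf-single _ a i refl others) (sumOf-single _ a i refl others)

starValueOf-empty : ∀ {k} (a : Vector ℕ k) → (∀ j → a j ≡ 0) → starValueOf a ≡ starValue 0 0
starValueOf-empty a empty = cong₂ starValue (sumOf-zero _ a λ j → cong (λ u → indicator (oneMod3 u)) (empty j))
                                            (sumOf-zero _ a λ j → cong (λ u → indicator (twoMod3 u)) (empty j))

starValueOf-withUnitLeg : ∀ {k} (a : Vector ℕ k) i m → a i ≡ 1 → m ≢ i → (∀ j → j ≢ i → j ≢ m → a j ≡ 0) →
                          starValueOf a ≡ starValue (suc (indicator (oneMod3 (a m)))) (indicator (twoMod3 (a m)))
starValueOf-withUnitLeg a i m unit m≢i others = cong₂ starValue
  (trans (count-decreases (removeUnit oneMod3)) (cong suc (countRest oneMod3 refl)))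
  (trans (sym (count-unchanged (removeUnit twoMod3))) (countRest twoMod3 refl))
  where
    rest : ∀ j → j ≢ m → (a [ i ]≔ 0) j ≡ 0
    rest j j≢m with j Fin.≟ i
    ... | yes refl = updateAt-updates i a
    ... | no j≢i = trans (updateAt-minimal j i a j≢i) (others j j≢i j≢m)
    countRest : ∀ p → p 0 ≡ false → count p (a [ i ]≔ 0) ≡ indicator (p (a m))
    countRest p p0 = trans (sumOf-single _ (a [ i ]≔ 0) m (cong indicator p0) rest)
                           (cong (λ u → indicator (p u)) (updateAt-minimal m i a m≢i))
    removeUnit : ∀ p → count p (a [ i ]≔ 0) + indicator (p 1) ≡ count p a + indicator (p 0)
    removeUnit p = subst (λ u → count p (a [ i ]≔ 0) + indicator (p u) ≡ count p a + indicator (p 0)) unit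
                     (sumOf-updateAt _ a i (const 0))

mod3≢singleLeg : ∀ u → mod3 u ≢ singleLegValue u
mod3≢singleLeg 0 ()
mod3≢singleLeg 1 ()
mod3≢singleLeg 2 ()
mod3≢singleLeg (suc (suc (suc u))) = mod3≢singleLeg u

mod3≢singleLeg-suc : ∀ u → mod3 u ≢ singleLegValue (suc u)
mod3≢singleLeg-suc 0 ()
mod3≢singleLeg-suc 1 ()
mod3≢singleLeg-suc 2 ()
mod3≢singleLeg-suc (suc (suc (suc u))) = mod3≢singleLeg-suc u

mod3≢withUnitLeg : ∀ u → mod3 u ≢ starValue (suc (indicator (oneMod3 u))) (indicator (twoMod3 u))
mod3≢withUnitLeg 0 ()
mod3≢withUnitLeg 1 ()
mod3≢withUnitLeg 2 ()
mod3≢withUnitLeg (suc (suc (suc u))) = mod3≢withUnitLeg u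

module Positions (G : Graph) where
  open Graph G using (V; Adj) renaming (_≟_ to _≟ᵥ_; sym to adj-sym)

  _∖_ : VSet G → VSet G → VSet G
  A ∖ X = _─_ G A X

  infix 4 _≐_
  _≐_ : VSet G → Pred V 0ℓ → Set
  A ≐ P = ∀ v → T (A v) ⇔ P v

  ≐-resp : ∀ {A P Q} → A ≐ P → (∀ v → P v ⇔ Q v) → A ≐ Q
  ≐-resp A≐P P⇔Q v = ⇔.trans (A≐P v) (P⇔Q v)

  ∖-≐ : ∀ {A X P Q} → A ≐ P → X ≐ Q → (A ∖ X) ≐ (P ∩ ∁ Q)
  ∖-≐ {A} {X} A≐P X≐Q v = mk⇔
    (λ t → let tA , tX = to T-∧ t in to (A≐P v) tA , λ q → notT (X v) tX (from (X≐Q v) q))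
    (λ (p , ¬q) → from T-∧ (from (A≐P v) p , Tnot (X v) (λ tX → ¬q (to (X≐Q v) tX))))
    where
      notT : ∀ b → T (not b) → ¬ T b
      notT false _ ()
      Tnot : ∀ b → ¬ T b → T (not b)
      Tnot false _ = tt
      Tnot true ¬t = ¬t tt

  ∖-keeps : ∀ {A X P Q v} → A ≐ P → X ≐ Q → P v → ¬ Q v → T ((A ∖ X) v)
  ∖-keeps A≐P X≐Q p ¬q = from (∖-≐ A≐P X≐Q _) (p , ¬q)

  ∖-removes : ∀ {A X P Q v} → A ≐ P → X ≐ Q → Q v → ¬ T ((A ∖ X) v)
  ∖-removes A≐P X≐Q q t = proj₂ (to (∖-≐ A≐P X≐Q _) t) q

  single-≐ : ∀ x → single G x ≐ ｛ x ｝
  single-≐ x v with x ≟ᵥ v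
  ... | yes e = mk⇔ (λ _ → e) (λ _ → tt)
  ... | no ne = mk⇔ (λ ()) ne

  pair-≐ : ∀ x y → pair G x y ≐ ｛ x ｝ ∪ ｛ y ｝
  pair-≐ x y v with x ≟ᵥ v | y ≟ᵥ v
  ... | yes e | _ = mk⇔ (λ _ → inj₁ e) (λ _ → tt)
  ... | no _ | yes e = mk⇔ (λ _ → inj₂ e) (λ _ → tt)
  ... | no x≢v | no y≢v = mk⇔ (λ ()) λ { (inj₁ e) → x≢v e ; (inj₂ e) → y≢v e }

  reach-trans : ∀ {A u v w} → Reach G A u v → Reach G A v w → Reach G A u w
  reach-trans p (here _) = p
  reach-trans p (step q adj t) = step (reach-trans p q) adj t

  reach-end : ∀ {A u v} → Reach G A u v → T (A v)
  reach-end (here t) = t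
  reach-end (step _ _ t) = t

  reach-sym : ∀ {A u v} → Reach G A u v → Reach G A v u
  reach-sym (here t) = here t
  reach-sym (step p adj t) = reach-trans (step (here t) (adj-sym adj) (reach-end p)) (reach-sym p)

  reach-preserves : ∀ {A} (S : Pred V 0ℓ) → (∀ {u v} → S u → Adj u v → T (A v) → S v) →
                    ∀ {u w} → Reach G A u w → S u → S w
  reach-preserves S closed (here _) s = s
  reach-preserves S closed (step p adj t) s = closed (reach-preserves S closed p s) adj t

  Connected : VSet G → Set
  Connected A = ∀ v w → T (A v) → T (A w) → Reach G A v w

  remainder-connected : ∀ {A X x} → Connected A → T (A x) → ComponentStaysConnected G A X x → Connected (A ∖ X)
  remainder-connected {A} {X} {x} conn ax stays v w tv tw =
    stays v w tv tw (conn x v ax (proj₁ (to T-∧ tv))) (conn x w ax (proj₁ (to T-∧ tw)))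

  connected-stays : ∀ {A X x} → Connected (A ∖ X) → ComponentStaysConnected G A X x
  connected-stays conn v w tv tw _ _ = conn v w tv tw

  ∅-connected : ∀ {A} → A ≐ ∅ → Connected A
  ∅-connected A≐∅ v _ tv = ⊥-elim (to (A≐∅ v) tv)

  ∅-grundy : ∀ {A} → A ≐ ∅ → HasGrundy G A 0
  ∅-grundy A≐∅ = grundy (λ { (one x ax _) → ⊥-elim (to (A≐∅ x) ax)
                           ; (two x _ ax _ _ _) → ⊥-elim (to (A≐∅ x) ax) })
                        (λ _ ())

module StarPositions (k : ℕ) (ℓ : Fin k → ℕ) where
  Sℓ : Graph
  Sℓ = Star k ℓ

  open Positions Sℓ

  SubStar : Vector ℕ k → Pred (StarV k ℓ) 0ℓ
  SubStar a centre = ⊤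
  SubStar a (node i j) = toℕ j < a i

  Segment : Fin k → ℕ → ℕ → Pred (StarV k ℓ) 0ℓ
  Segment i lo n centre = ⊥
  Segment i lo n (node i' j) = i ≡ i' × lo ≤ toℕ j × toℕ j < lo + n

  CentreEdge : Fin k → Pred (StarV k ℓ) 0ℓ
  CentreEdge i = ｛ centre ｝ ∪ Segment i 0 1

  Fits : Vector ℕ k → Set
  Fits a = ∀ i → a i ≤ ℓ i

  nodeAt : ∀ i m → m < ℓ i → Σ (Fin (ℓ i)) λ j → toℕ j ≡ m
  nodeAt i m m< = fromℕ< m< , toℕ-fromℕ< m<

  subStar-connected : ∀ {A a} → A ≐ SubStar a → Connected A
  subStar-connected {A} {a} A≐ v w tv tw = reach-trans (reach-sym (fromCentre v tv)) (fromCentre w tw)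
    where
      alongLeg : ∀ i n (j : Fin (ℓ i)) → toℕ j ≡ n → T (A (node i j)) → Reach Sℓ A centre (node i j)
      alongLeg i zero j e t = step (here (from (A≐ centre) tt)) (c-n j e) t
      alongLeg i (suc n) j e t =
        let j' , e' = nodeAt i n (≤-trans (n≤1+n (suc n)) (subst (_< ℓ i) e (toℕ<n j)))
            t' = from (A≐ (node i j')) (subst (_< a i) (sym e') (≤-trans (n≤1+n (suc n)) (subst (_< a i) e (to (A≐ (node i j)) t))))
        in step (alongLeg i n j' e' t') (n-n j' j (trans e (cong suc (sym e')))) t
      fromCentre : ∀ v → T (A v) → Reach Sℓ A centre v
      fromCentre centre t = here t
      fromCentre (node i j) t = alongLeg i (toℕ j) j refl t

  segment-connected : ∀ {A i lo len} → A ≐ Segment i lo len → Connected A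
  segment-connected {A} {i} {lo} {len} A≐ centre w tv tw = ⊥-elim (to (A≐ centre) tv)
  segment-connected {A} {i} {lo} {len} A≐ (node i' j) w tv tw with to (A≐ (node i' j)) tv
  ... | refl , lo≤j , _ =
    let j₀ , e₀ = nodeAt i lo (≤-<-trans lo≤j (toℕ<n j))
        t₀ = from (A≐ (node i j₀)) (refl , ≤-reflexive (sym e₀) ,
               subst (_< lo + len) (sym e₀) (≤-<-trans lo≤j (proj₂ (proj₂ (to (A≐ (node i j)) tv)))))
    in reach-trans (reach-sym (fromStart j₀ e₀ t₀ (node i j) tv)) (fromStart j₀ e₀ t₀ w tw)
    where
      alongFrom : (j₀ : Fin (ℓ i)) → toℕ j₀ ≡ lo → T (A (node i j₀)) →
                  ∀ d (j : Fin (ℓ i)) → toℕ j ≡ lo + d → T (A (node i j)) → Reach Sℓ A (node i j₀) (node i j)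
      alongFrom j₀ e₀ t₀ zero j e t with toℕ-injective (trans e₀ (trans (sym (+-identityʳ _)) (sym e)))
      ... | refl = here t
      alongFrom j₀ e₀ t₀ (suc d) j e t =
        let j' , e' = nodeAt i (lo + d)
                        (≤-trans (n≤1+n _) (≤-trans (s≤s (≤-reflexive (sym (+-suc lo d)))) (subst (_< ℓ i) e (toℕ<n j))))
            _ , _ , j< = to (A≐ (node i j)) t
            t' = from (A≐ (node i j')) (refl , subst (lo ≤_) (sym e') (m≤m+n lo d) ,
                   subst (_< lo + len) (sym e')
                     (≤-trans (≤-reflexive (sym (+-suc lo d))) (≤-trans (n≤1+n _) (subst (_< lo + len) e j<))))
        in step (alongFrom j₀ e₀ t₀ d j' e' t') (n-n j' j (trans e (trans (+-suc lo d) (cong suc (sym e'))))) t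
      fromStart : (j₀ : Fin (ℓ i)) → toℕ j₀ ≡ lo → T (A (node i j₀)) → ∀ v → T (A v) → Reach Sℓ A (node i j₀) v
      fromStart j₀ e₀ t₀ centre t = ⊥-elim (to (A≐ centre) t)
      fromStart j₀ e₀ t₀ (node i' j) t with to (A≐ (node i' j)) t
      ... | refl , lo≤j , _ = alongFrom j₀ e₀ t₀ (toℕ j ∸ lo) j (sym (m+[n∸m]≡n lo≤j)) t

  node-≐ : ∀ i (j : Fin (ℓ i)) → single Sℓ (node i j) ≐ Segment i (toℕ j) 1
  node-≐ i j = ≐-resp (single-≐ (node i j)) λ v → mk⇔ (into v) (outof v)
    where
      into : ∀ v → node i j ≡ v → Segment i (toℕ j) 1 v
      into _ refl = refl , ≤-refl , m<m+n (toℕ j) (s≤s z≤n)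
      outof : ∀ v → Segment i (toℕ j) 1 v → node i j ≡ v
      outof (node i' j') (refl , j≤j' , j'<)
        with toℕ-injective (≤-antisym j≤j' (≤-pred (≤-trans j'< (≤-reflexive (+-comm (toℕ j) 1)))))
      ... | refl = refl

  pair-swap : ∀ {x y P} → pair Sℓ x y ≐ P → pair Sℓ y x ≐ P
  pair-swap {x} {y} xy≐ v = ⇔.trans (pair-≐ y x v) (⇔.trans (mk⇔ swap swap) (⇔.trans (⇔.sym (pair-≐ x y v)) (xy≐ v)))

  edge-≐ : ∀ i (j j' : Fin (ℓ i)) → toℕ j' ≡ suc (toℕ j) → pair Sℓ (node i j) (node i j') ≐ Segment i (toℕ j) 2
  edge-≐ i j j' e = ≐-resp (pair-≐ _ _) λ v → mk⇔ (into v) (outof v)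
    where
      m = toℕ j
      into : ∀ v → node i j ≡ v ⊎ node i j' ≡ v → Segment i m 2 v
      into _ (inj₁ refl) = refl , ≤-refl , m<m+n m (s≤s z≤n)
      into _ (inj₂ refl) = refl , subst (m ≤_) (sym e) (n≤1+n m) ,
                           subst (_< m + 2) (sym e) (subst (suc m <_) (sym (+-comm m 2)) (n<1+n (suc m)))
      outof : ∀ v → Segment i m 2 v → node i j ≡ v ⊎ node i j' ≡ v
      outof (node .i j'') (refl , m≤ , <m+2) with m≤n⇒m<n∨m≡n m≤
      ... | inj₂ m≡ = inj₁ (cong (node i) (toℕ-injective m≡))
      ... | inj₁ m< =
        inj₂ (cong (node i) (toℕ-injective (trans e (≤-antisym m< (≤-pred (≤-trans <m+2 (≤-reflexive (+-comm m 2))))))))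

  centreEdge-≐ : ∀ i (j : Fin (ℓ i)) → toℕ j ≡ 0 → pair Sℓ centre (node i j) ≐ CentreEdge i
  centreEdge-≐ i j e = ≐-resp (pair-≐ _ _) λ v → mk⇔ (into v) (outof v)
    where
      into : ∀ v → centre ≡ v ⊎ node i j ≡ v → CentreEdge i v
      into v (inj₁ c) = inj₁ c
      into v (inj₂ refl) = inj₂ (refl , z≤n , subst (_< 1) (sym e) (s≤s z≤n))
      outof : ∀ v → CentreEdge i v → centre ≡ v ⊎ node i j ≡ v
      outof v (inj₁ c) = inj₁ c
      outof (node .i j') (inj₂ (refl , _ , j'<1)) = inj₂ (cong (node i) (toℕ-injective (trans e (sym (n<1⇒n≡0 j'<1)))))

  SubStar-shorten : ∀ a i m n → m + n ≡ a i → ∀ v → (SubStar a ∩ ∁ (Segment i m n)) v ⇔ SubStar (a [ i ]≔ m) v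
  SubStar-shorten a i m n e centre = mk⇔ (λ _ → tt) (λ _ → tt , λ ())
  SubStar-shorten a i m n e (node i' j) with i Fin.≟ i'
  ... | yes refl = mk⇔ into outof
    where
      into : (SubStar a ∩ ∁ (Segment i m n)) (node i j) → toℕ j < (a [ i ]≔ m) i
      into (j< , outside) with toℕ j <? m
      ... | yes j<m = subst (toℕ j <_) (sym (updateAt-updates i a)) j<m
      ... | no j≮m = ⊥-elim (outside (refl , ≮⇒≥ j≮m , subst (toℕ j <_) (sym e) j<))
      outof : toℕ j < (a [ i ]≔ m) i → (SubStar a ∩ ∁ (Segment i m n)) (node i j)
      outof j<' = let j<m = subst (toℕ j <_) (updateAt-updates i a) j<' in
        ≤-trans j<m (≤-trans (m≤m+n m n) (≤-reflexive e)) , λ (_ , m≤j , _) → <⇒≱ j<m m≤j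
  ... | no i≢i' = mk⇔ (λ (j< , _) → subst (toℕ j <_) (sym unchanged) j<)
                      (λ j< → subst (toℕ j <_) unchanged j< , λ (i≡i' , _) → i≢i' i≡i')
    where
      unchanged : (a [ i ]≔ m) i' ≡ a i'
      unchanged = updateAt-minimal i' i a (≢-sym i≢i')

  Segment-dropFront : ∀ i lo n len v → (Segment i lo (n + len) ∩ ∁ (Segment i lo n)) v ⇔ Segment i (lo + n) len v
  Segment-dropFront i lo n len centre = mk⇔ (λ { (() , _) }) λ ()
  Segment-dropFront i lo n len (node i' j) = mk⇔ into outof
    where
      into : (Segment i lo (n + len) ∩ ∁ (Segment i lo n)) (node i' j) → Segment i (lo + n) len (node i' j)
      into ((refl , lo≤j , j<) , outside) with toℕ j <? lo + n
      ... | yes j<lo+n = ⊥-elim (outside (refl , lo≤j , j<lo+n))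
      ... | no j≮lo+n = refl , ≮⇒≥ j≮lo+n , subst (toℕ j <_) (sym (+-assoc lo n len)) j<
      outof : Segment i (lo + n) len (node i' j) → (Segment i lo (n + len) ∩ ∁ (Segment i lo n)) (node i' j)
      outof (refl , lo+n≤j , j<) = (refl , ≤-trans (m≤m+n lo n) lo+n≤j , subst (toℕ j <_) (+-assoc lo n len) j<) ,
                                   λ (_ , _ , j<lo+n) → <⇒≱ j<lo+n lo+n≤j

  Segment-dropBack : ∀ i lo n len v → (Segment i lo (len + n) ∩ ∁ (Segment i (lo + len) n)) v ⇔ Segment i lo len v
  Segment-dropBack i lo n len centre = mk⇔ (λ { (() , _) }) λ ()
  Segment-dropBack i lo n len (node i' j) = mk⇔ into outof
    where
      into : (Segment i lo (len + n) ∩ ∁ (Segment i (lo + len) n)) (node i' j) → Segment i lo len (node i' j)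
      into ((refl , lo≤j , j<) , outside) with toℕ j <? lo + len
      ... | yes j<lo+len = refl , lo≤j , j<lo+len
      ... | no j≮lo+len = ⊥-elim (outside (refl , ≮⇒≥ j≮lo+len , subst (toℕ j <_) (sym (+-assoc lo len n)) j<))
      outof : Segment i lo len (node i' j) → (Segment i lo (len + n) ∩ ∁ (Segment i (lo + len) n)) (node i' j)
      outof (refl , lo≤j , j<) = (refl , lo≤j , ≤-trans j< (≤-trans (m≤m+n (lo + len) n) (≤-reflexive (+-assoc lo len n)))) ,
                                 λ (_ , lo+len≤j , _) → <⇒≱ j< lo+len≤j

  emptyLeg : ∀ a j (t : Fin (ℓ j)) → a j ≡ 0 → ¬ SubStar a (node j t)
  emptyLeg a j t e t< = <⇒≱ t< (≤-trans (≤-reflexive e) z≤n)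

  SubStar-centreRemoved-∅ : ∀ a → (∀ j → a j ≡ 0) → ∀ v → (SubStar a ∩ ∁ ｛ centre ｝) v ⇔ ∅ v
  SubStar-centreRemoved-∅ a empty v = mk⇔ (into v) λ ()
    where
      into : ∀ v → (SubStar a ∩ ∁ ｛ centre ｝) v → ⊥
      into centre (_ , notCentre) = notCentre refl
      into (node j t) (t< , _) = emptyLeg a j t (empty j) t<

  SubStar-centreRemoved-single : ∀ a i → (∀ j → j ≢ i → a j ≡ 0) →
                                 ∀ v → (SubStar a ∩ ∁ ｛ centre ｝) v ⇔ Segment i 0 (a i) v
  SubStar-centreRemoved-single a i others centre = mk⇔ (λ (_ , notCentre) → ⊥-elim (notCentre refl)) λ ()
  SubStar-centreRemoved-single a i others (node j t) = mk⇔ (into (i Fin.≟ j)) λ { (refl , _ , t<) → t< , λ () }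
    where
      into : Dec (i ≡ j) → (SubStar a ∩ ∁ ｛ centre ｝) (node j t) → Segment i 0 (a i) (node j t)
      into (yes refl) (t< , _) = refl , z≤n , t<
      into (no i≢j) (t< , _) = ⊥-elim (emptyLeg a j t (others j (≢-sym i≢j)) t<)

  SubStar-centreEdgeRemoved-∅ : ∀ a i → a i ≡ 1 → (∀ j → j ≢ i → a j ≡ 0) →
                                ∀ v → (SubStar a ∩ ∁ (CentreEdge i)) v ⇔ ∅ v
  SubStar-centreEdgeRemoved-∅ a i unit others v = mk⇔ (into v) λ ()
    where
      into : ∀ v → (SubStar a ∩ ∁ (CentreEdge i)) v → ⊥
      into centre (_ , outside) = outside (inj₁ refl)
      into (node j t) (t< , outside) with i Fin.≟ j
      ... | yes refl = outside (inj₂ (refl , z≤n , subst (toℕ t <_) unit t<))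
      ... | no i≢j = emptyLeg a j t (others j (≢-sym i≢j)) t<

  SubStar-centreEdgeRemoved-other : ∀ a i m → a i ≡ 1 → m ≢ i → (∀ j → j ≢ i → j ≢ m → a j ≡ 0) →
                                    ∀ v → (SubStar a ∩ ∁ (CentreEdge i)) v ⇔ Segment m 0 (a m) v
  SubStar-centreEdgeRemoved-other a i m unit m≢i others centre = mk⇔ (λ (_ , outside) → ⊥-elim (outside (inj₁ refl))) λ ()
  SubStar-centreEdgeRemoved-other a i m unit m≢i others (node j t) =
    mk⇔ (into (m Fin.≟ j) (i Fin.≟ j)) λ { (refl , _ , t<) → t< , λ { (inj₁ ()) ; (inj₂ (i≡m , _)) → m≢i (sym i≡m) } }
    where
      into : Dec (m ≡ j) → Dec (i ≡ j) → (SubStar a ∩ ∁ (CentreEdge i)) (node j t) → Segment m 0 (a m) (node j t)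
      into (yes refl) _ (t< , _) = refl , z≤n , t<
      into (no _) (yes refl) (t< , outside) = ⊥-elim (outside (inj₂ (refl , z≤n , subst (toℕ t <_) unit t<)))
      into (no m≢j) (no i≢j) (t< , _) = ⊥-elim (emptyLeg a j t (others j (≢-sym i≢j) (≢-sym m≢j)) t<)

  SubStar-centreEdgeRemoved-rest : ∀ a i n → a i ≡ suc (suc n) → (∀ j → j ≢ i → a j ≡ 0) →
                                   ∀ v → (SubStar a ∩ ∁ (CentreEdge i)) v ⇔ Segment i 1 (suc n) v
  SubStar-centreEdgeRemoved-rest a i n long others centre = mk⇔ (λ (_ , outside) → ⊥-elim (outside (inj₁ refl))) λ ()
  SubStar-centreEdgeRemoved-rest a i n long others (node j t) =
    mk⇔ (into (i Fin.≟ j)) λ { (refl , 1≤t , t<) → subst (toℕ t <_) (sym long) t< ,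
                                                    λ { (inj₁ ()) ; (inj₂ (_ , _ , t<1)) → <⇒≱ t<1 1≤t } }
    where
      into : Dec (i ≡ j) → (SubStar a ∩ ∁ (CentreEdge i)) (node j t) → Segment i 1 (suc n) (node j t)
      into (yes refl) (t< , outside) with toℕ t <? 1
      ... | yes t<1 = ⊥-elim (outside (inj₂ (refl , z≤n , t<1)))
      ... | no t≮1 = refl , ≮⇒≥ t≮1 , subst (toℕ t <_) long t<
      into (no i≢j) (t< , _) = ⊥-elim (emptyLeg a j t (others j (≢-sym i≢j)) t<)

  OnLeg : Fin k → Pred (StarV k ℓ) 0ℓ
  OnLeg i centre = ⊥
  OnLeg i (node i' _) = i ≡ i'

  reach-staysOnLeg : ∀ {A} i → ¬ T (A centre) → ∀ {u w} → Reach Sℓ A u w → OnLeg i u → OnLeg i w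
  reach-staysOnLeg {A} i centreGone = reach-preserves (OnLeg i) closed
    where
      closed : ∀ {u v} → OnLeg i u → StarAdj u v → T (A v) → OnLeg i v
      closed {node _ _} _ (n-c _ _) tv = ⊥-elim (centreGone tv)
      closed {node _ _} onLeg (n-n _ _ _) _ = onLeg
      closed {node _ _} onLeg (n-n' _ _ _) _ = onLeg

  Beyond : Fin k → ℕ → Pred (StarV k ℓ) 0ℓ
  Beyond i m centre = ⊥
  Beyond i m (node i' t) = i ≡ i' × m < toℕ t

  reach-staysBeyond : ∀ {A} i m → (∀ (t : Fin (ℓ i)) → toℕ t ≡ m → ¬ T (A (node i t))) →
                      ∀ {u w} → Reach Sℓ A u w → Beyond i m u → Beyond i m w
  reach-staysBeyond {A} i m gap = reach-preserves (Beyond i m) closed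
    where
      closed : ∀ {u v} → Beyond i m u → StarAdj u v → T (A v) → Beyond i m v
      closed {node .i t} (refl , m<t) (n-c _ t≡0) _ = ⊥-elim (<⇒≱ m<t (≤-trans (≤-reflexive t≡0) z≤n))
      closed {node .i t} (refl , m<t) (n-n _ t' e) _ = refl , ≤-trans m<t (≤-trans (n≤1+n _) (≤-reflexive (sym e)))
      closed {node .i t} (refl , m<t) (n-n' _ t' e) tv with m≤n⇒m<n∨m≡n (≤-pred (≤-trans m<t (≤-reflexive e)))
      ... | inj₁ m<t' = refl , m<t'
      ... | inj₂ m≡t' = ⊥-elim (gap t' (sym m≡t') tv)

  record IsSegment (i : Fin k) (len : ℕ) (B : VSet Sℓ) : Set where
    constructor segment
    field
      start : ℕ
      described : B ≐ Segment i start len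
      fits : start + len ≤ ℓ i

  ShorterSegment : Fin k → ℕ → VSet Sℓ → Set
  ShorterSegment i len B = Σ ℕ λ len' → Shortens len len' × IsSegment i len' B

  shortens-by : ∀ {n len len'} → n ≤ 1 → len ≡ suc n + len' → Shortens len len'
  shortens-by z≤n e = inj₁ e
  shortens-by (s≤s z≤n) e = inj₂ e

  interiorBlock-disconnects : ∀ {A X i lo len m n} → A ≐ Segment i lo len → lo + len ≤ ℓ i →
    X ≐ Segment i m (suc n) → lo < m → m + suc n < lo + len → ¬ Connected (A ∖ X)
  interiorBlock-disconnects {A} {X} {i} {lo} {len} {suc m₀} {n} A≐ fits X≐ (s≤s lo≤m₀) end< conn =
    <⇒≱ (proj₂ (reach-staysBeyond i (suc m₀ + n) gap (conn _ _ afterAlive beforeAlive) afterBeyond))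
        (subst (_≤ suc m₀ + n) (sym before≡) m₀≤)
    where
      m₀≤ : m₀ ≤ suc m₀ + n
      m₀≤ = ≤-trans (n≤1+n m₀) (m≤m+n (suc m₀) n)
      last< : suc m₀ + n < suc m₀ + suc n
      last< = +-monoʳ-< (suc m₀) (n<1+n n)
      block< : suc m₀ + suc n < ℓ i
      block< = <-≤-trans end< fits
      alive : ∀ (j : Fin (ℓ i)) → lo ≤ toℕ j → toℕ j < lo + len → ¬ Segment i (suc m₀) (suc n) (node i j) →
              T ((A ∖ X) (node i j))
      alive j lo≤j j<end outside = ∖-keeps A≐ X≐ (refl , lo≤j , j<end) outside
      gap : ∀ (t : Fin (ℓ i)) → toℕ t ≡ suc m₀ + n → ¬ T ((A ∖ X) (node i t))
      gap t t≡ = ∖-removes A≐ X≐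
        (refl , subst (suc m₀ ≤_) (sym t≡) (m≤m+n (suc m₀) n) , subst (_< suc m₀ + suc n) (sym t≡) last<)
      before = proj₁ (nodeAt i m₀ (≤-<-trans (≤-trans m₀≤ (<⇒≤ last<)) block<))
      before≡ = proj₂ (nodeAt i m₀ (≤-<-trans (≤-trans m₀≤ (<⇒≤ last<)) block<))
      beforeAlive : T ((A ∖ X) (node i before))
      beforeAlive = alive before (subst (lo ≤_) (sym before≡) lo≤m₀)
        (subst (_< lo + len) (sym before≡) (≤-<-trans (≤-trans m₀≤ (<⇒≤ last<)) end<))
        λ (_ , m≤ , _) → 1+n≰n (subst (suc m₀ ≤_) before≡ m≤)
      after = proj₁ (nodeAt i (suc m₀ + suc n) block<)
      after≡ = proj₂ (nodeAt i (suc m₀ + suc n) block<)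
      afterAlive : T ((A ∖ X) (node i after))
      afterAlive = alive after (subst (lo ≤_) (sym after≡) (≤-trans lo≤m₀ (≤-trans m₀≤ (<⇒≤ last<))))
        (subst (_< lo + len) (sym after≡) end<)
        λ (_ , _ , <end) → 1+n≰n (subst (_< suc m₀ + suc n) after≡ <end)
      afterBeyond : Beyond i (suc m₀ + n) (node i after)
      afterBeyond = refl , subst (suc m₀ + n <_) (sym after≡) last<

  segment-removeBlock : ∀ {A X i lo len m n} → A ≐ Segment i lo len → lo + len ≤ ℓ i →
    X ≐ Segment i m (suc n) → n ≤ 1 → lo ≤ m → m + suc n ≤ lo + len → Connected (A ∖ X) → ShorterSegment i len (A ∖ X)
  segment-removeBlock {A} {X} {i} {lo} {len} {m} {n} A≐ fits X≐ n≤1 lo≤m end≤ conn with m ≟ lo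
  ... | yes refl =
    let rest = len ∸ suc n
        len≡ : len ≡ suc n + rest
        len≡ = sym (m+[n∸m]≡n (+-cancelˡ-≤ m _ _ end≤))
        B≐ = ≐-resp (∖-≐ (subst (λ L → A ≐ Segment i m L) len≡ A≐) X≐) (Segment-dropFront i m (suc n) rest)
    in rest , shortens-by n≤1 len≡ ,
       segment (m + suc n) B≐ (≤-trans (≤-reflexive (trans (+-assoc m (suc n) rest) (cong (m +_) (sym len≡)))) fits)
  ... | no m≢lo with m + suc n ≟ lo + len
  ...   | yes end≡ =
    let rest = m ∸ lo
        m≡ : m ≡ lo + rest
        m≡ = sym (m+[n∸m]≡n lo≤m)
        len≡ : len ≡ rest + suc n
        len≡ = +-cancelˡ-≡ lo _ _ (trans (sym end≡) (trans (cong (_+ suc n) m≡) (+-assoc lo rest (suc n))))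
        B≐ = ≐-resp (∖-≐ (subst (λ L → A ≐ Segment i lo L) len≡ A≐) (subst (λ M → X ≐ Segment i M (suc n)) m≡ X≐))
                    (Segment-dropBack i lo (suc n) rest)
    in rest , shortens-by n≤1 (trans len≡ (+-comm rest (suc n))) ,
       segment lo B≐ (≤-trans (+-monoʳ-≤ lo (≤-trans (m≤m+n rest (suc n)) (≤-reflexive (sym len≡)))) fits)
  ...   | no end≢ =
    ⊥-elim (interiorBlock-disconnects A≐ fits X≐ (≤∧≢⇒< lo≤m (≢-sym m≢lo)) (≤∧≢⇒< end≤ end≢) conn)

  segmentMove-shortens : ∀ {A i lo len} → A ≐ Segment i lo len → lo + len ≤ ℓ i →
                         (mv : Move Sℓ A) → ShorterSegment i len (result Sℓ mv)
  segmentMove-shortens A≐ fits (one centre ax _) = ⊥-elim (to (A≐ centre) ax)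
  segmentMove-shortens {A} {i} {lo} {len} A≐ fits (one (node i' j) ax stays) with to (A≐ (node i' j)) ax
  ... | refl , lo≤j , j< =
    segment-removeBlock A≐ fits (node-≐ i j) z≤n lo≤j (≤-trans (≤-reflexive (+-comm (toℕ j) 1)) j<)
      (remainder-connected (segment-connected A≐) ax stays)
  segmentMove-shortens A≐ fits (two _ _ ax _ (c-n _ _) _) = ⊥-elim (to (A≐ centre) ax)
  segmentMove-shortens A≐ fits (two _ _ _ ay (n-c _ _) _) = ⊥-elim (to (A≐ centre) ay)
  segmentMove-shortens {A} {i} {lo} {len} A≐ fits (two (node i' j) (node .i' j') ax ay (n-n .j .j' e) stays)
    with to (A≐ (node i' j)) ax
  ... | refl , lo≤j , _ =
    segment-removeBlock A≐ fits (edge-≐ i j j' e) (s≤s z≤n) lo≤j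
      (≤-trans (≤-reflexive (+-comm (toℕ j) 2)) (subst (_< lo + len) e (proj₂ (proj₂ (to (A≐ (node i j')) ay)))))
      (remainder-connected (segment-connected A≐) ax stays)
  segmentMove-shortens {A} {i} {lo} {len} A≐ fits (two (node i' j) (node .i' j') ax ay (n-n' .j .j' e) stays)
    with to (A≐ (node i' j')) ay
  ... | refl , lo≤j' , _ =
    segment-removeBlock A≐ fits (pair-swap {node i j'} {node i j} (edge-≐ i j' j e)) (s≤s z≤n) lo≤j'
      (≤-trans (≤-reflexive (+-comm (toℕ j') 2)) (subst (_< lo + len) e (proj₂ (proj₂ (to (A≐ (node i j)) ax)))))
      (remainder-connected (segment-connected A≐) ax stays)

  segment-shortening : ∀ {A i lo len len'} → A ≐ Segment i lo len → lo + len ≤ ℓ i → Shortens len len' →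
                       Σ (Move Sℓ A) λ mv → IsSegment i len' (result Sℓ mv)
  segment-shortening {A} {i} {lo} {_} {len'} A≐ fits (inj₁ refl) =
    let j₀ , e₀ = nodeAt i lo (≤-trans (m<m+n lo (s≤s z≤n)) fits)
        X≐ = subst (λ M → single Sℓ (node i j₀) ≐ Segment i M 1) e₀ (node-≐ i j₀)
        B≐ = ≐-resp (∖-≐ A≐ X≐) (Segment-dropFront i lo 1 len')
        ax = from (A≐ (node i j₀)) (refl , ≤-reflexive (sym e₀) , subst (_< lo + suc len') (sym e₀) (m<m+n lo (s≤s z≤n)))
    in one (node i j₀) ax (connected-stays (segment-connected B≐)) ,
       segment (lo + 1) B≐ (≤-trans (≤-reflexive (+-assoc lo 1 len')) fits)
  segment-shortening {A} {i} {lo} {_} {len'} A≐ fits (inj₂ refl) =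
    let lo< = m<m+n lo (s≤s z≤n)
        1+lo< = ≤-trans (≤-reflexive (cong suc (+-comm 1 lo))) (+-monoʳ-< lo (s≤s (s≤s z≤n)))
        j₀ , e₀ = nodeAt i lo (≤-trans lo< fits)
        j₁ , e₁ = nodeAt i (suc lo) (≤-trans 1+lo< fits)
        adjacent = trans e₁ (cong suc (sym e₀))
        X≐ = subst (λ M → pair Sℓ (node i j₀) (node i j₁) ≐ Segment i M 2) e₀ (edge-≐ i j₀ j₁ adjacent)
        B≐ = ≐-resp (∖-≐ A≐ X≐) (Segment-dropFront i lo 2 len')
        ax = from (A≐ (node i j₀)) (refl , ≤-reflexive (sym e₀) , subst (_< lo + suc (suc len')) (sym e₀) lo<)
        ay = from (A≐ (node i j₁)) (refl , subst (lo ≤_) (sym e₁) (n≤1+n lo) , subst (_< lo + suc (suc len')) (sym e₁) 1+lo<)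
    in two (node i j₀) (node i j₁) ax ay (n-n j₀ j₁ adjacent) (connected-stays (segment-connected B≐)) ,
       segment (lo + 2) B≐ (≤-trans (≤-reflexive (+-assoc lo 2 len')) fits)

  segment-grundy : ∀ len {A i} → IsSegment i len A → HasGrundy Sℓ A (mod3 len)
  segment-grundy = <-rec _ λ len rec {A} {i} → λ where
    (segment lo A≐ fits) → grundy
      (λ mv → let len' , sh , B = segmentMove-shortens A≐ fits mv in
              mod3 len' , mod3-shortens≢ sh , rec (shortens⇒< sh) B)
      (λ h h< → let len' , sh , h≡ = mod3-below len h h<
                    mv , B = segment-shortening A≐ fits sh in
                mv , subst (HasGrundy Sℓ _) (sym h≡) (rec (shortens⇒< sh) B))

  data StarOption (a : Vector ℕ k) (B : VSet Sℓ) : Set where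
    shorterStar : ∀ i v → Shortens (a i) v → B ≐ SubStar (a [ i ]≔ v) → StarOption a B
    pathLeft : ∀ i len → IsSegment i len B → mod3 len ≢ starValueOf a → StarOption a B
    nothingLeft : B ≐ ∅ → mod3 0 ≢ starValueOf a → StarOption a B

  positiveLeg? : ∀ (a : Vector ℕ k) (P : Pred (Fin k) 0ℓ) → (∀ j → Dec (P j)) →
                 (∀ j → P j → a j ≡ 0) ⊎ Σ (Fin k) λ j → P j × 0 < a j
  positiveLeg? a P P? with any? (λ j → P? j ×-dec (0 <? a j))
  ... | yes (j , pj , pos) = inj₂ (j , pj , pos)
  ... | no none = inj₁ λ j pj → n≤0⇒n≡0 (≮⇒≥ λ pos → none (j , pj , pos))

  unitOrLonger : ∀ {u} → 0 < u → u ≡ 1 ⊎ Σ ℕ λ n → u ≡ suc (suc n)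
  unitOrLonger {suc zero} _ = inj₁ refl
  unitOrLonger {suc (suc n)} _ = inj₂ (n , refl)

  firstVertex : ∀ {a} → Fits a → ∀ i → 0 < a i → Σ (Fin (ℓ i)) λ t → toℕ t ≡ 0
  firstVertex fits i pos = nodeAt i 0 (≤-trans pos (fits i))

  legs-disconnected : ∀ {B} → ¬ T (B centre) → Connected B → ∀ {i j} (t : Fin (ℓ i)) (u : Fin (ℓ j)) →
                      T (B (node i t)) → T (B (node j u)) → i ≡ j
  legs-disconnected centreGone conn t u tt' tu = reach-staysOnLeg _ centreGone (conn _ _ tt' tu) refl

  subStar-removeFromLeg : ∀ {A X a i m n} → A ≐ SubStar a → Fits a → X ≐ Segment i m (suc n) → n ≤ 1 →
                          m + suc n ≤ a i → Connected (A ∖ X) → StarOption a (A ∖ X)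
  subStar-removeFromLeg {A} {X} {a} {i} {m} {n} A≐ fits X≐ n≤1 end≤ conn with m + suc n ≟ a i
  ... | yes end≡ = shorterStar i m (shortens-by n≤1 (trans (sym end≡) (+-comm m (suc n))))
                     (≐-resp (∖-≐ A≐ X≐) (SubStar-shorten a i m (suc n) end≡))
  ... | no end≢ = ⊥-elim (reach-staysBeyond i (m + n) gap (conn _ _ afterAlive centreAlive) afterBeyond)
    where
      end< : m + suc n < a i
      end< = ≤∧≢⇒< end≤ end≢
      last< : m + n < m + suc n
      last< = +-monoʳ-< m (n<1+n n)
      after = proj₁ (nodeAt i (m + suc n) (<-≤-trans end< (fits i)))
      after≡ = proj₂ (nodeAt i (m + suc n) (<-≤-trans end< (fits i)))
      afterAlive : T ((A ∖ X) (node i after))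
      afterAlive = ∖-keeps A≐ X≐ (subst (_< a i) (sym after≡) end<)
                     λ (_ , _ , <end) → 1+n≰n (subst (_< m + suc n) after≡ <end)
      afterBeyond : Beyond i (m + n) (node i after)
      afterBeyond = refl , subst (m + n <_) (sym after≡) last<
      centreAlive : T ((A ∖ X) centre)
      centreAlive = ∖-keeps A≐ X≐ tt λ ()
      gap : ∀ (t : Fin (ℓ i)) → toℕ t ≡ m + n → ¬ T ((A ∖ X) (node i t))
      gap t t≡ = ∖-removes A≐ X≐ (refl , subst (m ≤_) (sym t≡) (m≤m+n m n) , subst (_< m + suc n) (sym t≡) last<)

  firstVertex-kept : ∀ {A X a Q} → A ≐ SubStar a → X ≐ Q → (fits : Fits a) → ∀ j (pos : 0 < a j) →
                     ¬ Q (node j (proj₁ (firstVertex fits j pos))) → T ((A ∖ X) (node j (proj₁ (firstVertex fits j pos))))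
  firstVertex-kept {a = a} A≐ X≐ fits j pos = ∖-keeps A≐ X≐ (subst (_< a j) (sym (proj₂ (firstVertex fits j pos))) pos)

  centreEdge-otherLeg : ∀ {i j} (t : Fin (ℓ j)) → j ≢ i → ¬ CentreEdge i (node j t)
  centreEdge-otherLeg t j≢i (inj₂ (i≡j , _)) = j≢i (sym i≡j)

  subStar-removeCentre : ∀ {A a} → A ≐ SubStar a → Fits a → Connected (A ∖ single Sℓ centre) →
                         StarOption a (A ∖ single Sℓ centre)
  subStar-removeCentre {A} {a} A≐ fits conn with positiveLeg? a (λ _ → ⊤) (λ _ → yes tt)
  ... | inj₁ none =
    nothingLeft (≐-resp (∖-≐ A≐ (single-≐ centre)) (SubStar-centreRemoved-∅ a empty))
                (λ e → mod3≢singleLeg 0 (trans e (starValueOf-empty a empty)))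
    where
      empty : ∀ j → a j ≡ 0
      empty j = none j tt
  ... | inj₂ (i , _ , pos-i) with positiveLeg? a (_≢ i) (λ j → ¬? (j Fin.≟ i))
  ...   | inj₁ others =
    pathLeft i (a i) (segment 0 (≐-resp (∖-≐ A≐ (single-≐ centre)) (SubStar-centreRemoved-single a i others)) (fits i))
             (λ e → mod3≢singleLeg (a i) (trans e (starValueOf-single a i others)))
  ...   | inj₂ (j , j≢i , pos-j) =
    ⊥-elim (j≢i (sym (legs-disconnected (∖-removes A≐ centre≐ refl) conn _ _
                        (firstVertex-kept A≐ centre≐ fits i pos-i λ ()) (firstVertex-kept A≐ centre≐ fits j pos-j λ ()))))
    where centre≐ = single-≐ centre

  subStar-removeCentreEdge : ∀ {A X a i} → A ≐ SubStar a → Fits a → X ≐ CentreEdge i → 0 < a i →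
                             Connected (A ∖ X) → StarOption a (A ∖ X)
  subStar-removeCentreEdge {A} {X} {a} {i} A≐ fits X≐ pos-i conn with positiveLeg? a (_≢ i) (λ j → ¬? (j Fin.≟ i))
  ... | inj₁ others with unitOrLonger pos-i
  ...   | inj₁ unit =
    nothingLeft (≐-resp (∖-≐ A≐ X≐) (SubStar-centreEdgeRemoved-∅ a i unit others))
                (λ e → mod3≢singleLeg-suc 0 (trans e (trans (starValueOf-single a i others) (cong singleLegValue unit))))
  ...   | inj₂ (n , long) =
    pathLeft i (suc n) (segment 1 (≐-resp (∖-≐ A≐ X≐) (SubStar-centreEdgeRemoved-rest a i n long others))
                                  (≤-trans (≤-reflexive (sym long)) (fits i)))
             (λ e → mod3≢singleLeg-suc (suc n) (trans e (trans (starValueOf-single a i others) (cong singleLegValue long))))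
  subStar-removeCentreEdge {A} {X} {a} {i} A≐ fits X≐ pos-i conn | inj₂ (m , m≢i , pos-m) with unitOrLonger pos-i
  ... | inj₂ (n , long) =
    ⊥-elim (m≢i (legs-disconnected (∖-removes A≐ X≐ (inj₁ refl)) conn _ _
                   (firstVertex-kept A≐ X≐ fits m pos-m (centreEdge-otherLeg _ m≢i)) secondKept))
    where
      1<a : 1 < a i
      1<a = subst (1 <_) (sym long) (s≤s (s≤s z≤n))
      second = nodeAt i 1 (<-≤-trans 1<a (fits i))
      secondKept : T ((A ∖ X) (node i (proj₁ second)))
      secondKept = ∖-keeps A≐ X≐ (subst (_< a i) (sym (proj₂ second)) 1<a)
                     λ { (inj₁ ()) ; (inj₂ (_ , _ , <1)) → <⇒≱ <1 (≤-reflexive (sym (proj₂ second))) }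
  ... | inj₁ unit with positiveLeg? a (λ j → j ≢ i × j ≢ m) (λ j → ¬? (j Fin.≟ i) ×-dec ¬? (j Fin.≟ m))
  ...   | inj₁ others =
    pathLeft m (a m) (segment 0 (≐-resp (∖-≐ A≐ X≐) (SubStar-centreEdgeRemoved-other a i m unit m≢i others')) (fits m))
             (λ e → mod3≢withUnitLeg (a m) (trans e (starValueOf-withUnitLeg a i m unit m≢i others')))
    where
      others' : ∀ j → j ≢ i → j ≢ m → a j ≡ 0
      others' j j≢i j≢m = others j (j≢i , j≢m)
  ...   | inj₂ (m' , (m'≢i , m'≢m) , pos-m') =
    ⊥-elim (m'≢m (sym (legs-disconnected (∖-removes A≐ X≐ (inj₁ refl)) conn _ _
                         (firstVertex-kept A≐ X≐ fits m pos-m (centreEdge-otherLeg _ m≢i))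
                         (firstVertex-kept A≐ X≐ fits m' pos-m' (centreEdge-otherLeg _ m'≢i)))))

  subStarMove-option : ∀ {A a} → A ≐ SubStar a → Fits a → (mv : Move Sℓ A) → StarOption a (result Sℓ mv)
  subStarMove-option A≐ fits (one centre ax stays) =
    subStar-removeCentre A≐ fits (remainder-connected (subStar-connected A≐) ax stays)
  subStarMove-option A≐ fits (one (node i j) ax stays) =
    subStar-removeFromLeg A≐ fits (node-≐ i j) z≤n (≤-trans (≤-reflexive (+-comm (toℕ j) 1)) (to (A≐ (node i j)) ax))
      (remainder-connected (subStar-connected A≐) ax stays)
  subStarMove-option A≐ fits (two centre (node i j) ax ay (c-n .j e) stays) =
    subStar-removeCentreEdge A≐ fits (centreEdge-≐ i j e) (≤-<-trans z≤n (to (A≐ (node i j)) ay))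
      (remainder-connected (subStar-connected A≐) ax stays)
  subStarMove-option A≐ fits (two (node i j) centre ax ay (n-c .j e) stays) =
    subStar-removeCentreEdge A≐ fits (pair-swap {centre} {node i j} (centreEdge-≐ i j e)) (≤-<-trans z≤n (to (A≐ (node i j)) ax))
      (remainder-connected (subStar-connected A≐) ax stays)
  subStarMove-option {a = a} A≐ fits (two (node i j) (node .i j') ax ay (n-n .j .j' e) stays) =
    subStar-removeFromLeg A≐ fits (edge-≐ i j j' e) (s≤s z≤n)
      (≤-trans (≤-reflexive (+-comm (toℕ j) 2)) (subst (_< a i) e (to (A≐ (node i j')) ay)))
      (remainder-connected (subStar-connected A≐) ax stays)
  subStarMove-option {a = a} A≐ fits (two (node i j) (node .i j') ax ay (n-n' .j .j' e) stays) =
    subStar-removeFromLeg A≐ fits (pair-swap {node i j'} {node i j} (edge-≐ i j' j e)) (s≤s z≤n)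
      (≤-trans (≤-reflexive (+-comm (toℕ j') 2)) (subst (_< a i) e (to (A≐ (node i j)) ax)))
      (remainder-connected (subStar-connected A≐) ax stays)

  subStar-shortening : ∀ {A a i v} → A ≐ SubStar a → Fits a → Shortens (a i) v →
                       Σ (Move Sℓ A) λ mv → result Sℓ mv ≐ SubStar (a [ i ]≔ v)
  subStar-shortening {A} {a} {i} {v} A≐ fits (inj₁ a≡) =
    let v<a = ≤-reflexive (sym a≡)
        j , j≡ = nodeAt i v (≤-trans v<a (fits i))
        X≐ = subst (λ M → single Sℓ (node i j) ≐ Segment i M 1) j≡ (node-≐ i j)
        B≐ = ≐-resp (∖-≐ A≐ X≐) (SubStar-shorten a i v 1 (trans (+-comm v 1) (sym a≡)))
        ax = from (A≐ (node i j)) (subst (_< a i) (sym j≡) v<a)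
    in one (node i j) ax (connected-stays (subStar-connected B≐)) , B≐
  subStar-shortening {A} {a} {i} {v} A≐ fits (inj₂ a≡) =
    let 1+v<a = ≤-reflexive (sym a≡)
        v<a = ≤-trans (n≤1+n (suc v)) 1+v<a
        j₀ , j₀≡ = nodeAt i v (≤-trans v<a (fits i))
        j₁ , j₁≡ = nodeAt i (suc v) (≤-trans 1+v<a (fits i))
        adjacent = trans j₁≡ (cong suc (sym j₀≡))
        X≐ = subst (λ M → pair Sℓ (node i j₀) (node i j₁) ≐ Segment i M 2) j₀≡ (edge-≐ i j₀ j₁ adjacent)
        B≐ = ≐-resp (∖-≐ A≐ X≐) (SubStar-shorten a i v 2 (trans (+-comm v 2) (sym a≡)))
        ax = from (A≐ (node i j₀)) (subst (_< a i) (sym j₀≡) v<a)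
        ay = from (A≐ (node i j₁)) (subst (_< a i) (sym j₁≡) 1+v<a)
    in two (node i j₀) (node i j₁) ax ay (n-n j₀ j₁ adjacent) (connected-stays (subStar-connected B≐)) , B≐

  subStar-clearCentre : ∀ {A a} → A ≐ SubStar a → (∀ j → a j ≡ 0) →
                        Σ (Move Sℓ A) λ mv → result Sℓ mv ≐ ∅
  subStar-clearCentre {A} {a} A≐ empty =
    let B≐ = ≐-resp (∖-≐ A≐ (single-≐ centre)) (SubStar-centreRemoved-∅ a empty)
    in one centre (from (A≐ centre) tt) (connected-stays (∅-connected B≐)) , B≐

  subStar-clearUnitLeg : ∀ {A a i} → A ≐ SubStar a → Fits a → a i ≡ 1 → (∀ j → j ≢ i → a j ≡ 0) →
                         Σ (Move Sℓ A) λ mv → result Sℓ mv ≐ ∅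
  subStar-clearUnitLeg {A} {a} {i} A≐ fits unit others =
    let t , t≡ = nodeAt i 0 (≤-trans (≤-reflexive (sym unit)) (fits i))
        B≐ = ≐-resp (∖-≐ A≐ (centreEdge-≐ i t t≡)) (SubStar-centreEdgeRemoved-∅ a i unit others)
        at = from (A≐ (node i t)) (subst (_< a i) (sym t≡) (≤-reflexive (sym unit)))
    in two centre (node i t) (from (A≐ centre) tt) at (c-n t t≡) (connected-stays (∅-connected B≐)) , B≐

  fits-[]≔ : ∀ {a} → Fits a → ∀ i v → v ≤ a i → Fits (a [ i ]≔ v)
  fits-[]≔ {a} fits i v v≤ j with j Fin.≟ i
  ... | yes refl = subst (_≤ ℓ j) (sym (updateAt-updates j a)) (≤-trans v≤ (fits j))
  ... | no j≢i = subst (_≤ ℓ j) (sym (updateAt-minimal j i a j≢i)) (fits j)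

  ShortersKnown : ∀ {a} → Fits a → Set
  ShortersKnown {a} fits = ∀ {i v} → Shortens (a i) v → ∀ {B} → B ≐ SubStar (a [ i ]≔ v) →
                           HasGrundy Sℓ B (starValueOf (a [ i ]≔ v))

  subStar-optionValue : ∀ {a B} (fits : Fits a) → ShortersKnown fits → StarOption a B →
                        Σ ℕ λ h → h ≢ starValueOf a × HasGrundy Sℓ B h
  subStar-optionValue {a} fits known (shorterStar i v sh B≐) =
    starValueOf (a [ i ]≔ v) , starValueOf-shortens a i v sh , known sh B≐
  subStar-optionValue fits known (pathLeft i len seg neq) = mod3 len , neq , segment-grundy len seg
  subStar-optionValue fits known (nothingLeft B≐ neq) = 0 , neq , ∅-grundy B≐

  ReachesValue : VSet Sℓ → ℕ → Set
  ReachesValue A h = Σ (Move Sℓ A) λ mv → HasGrundy Sℓ (result Sℓ mv) h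

  subStar-shortenTo : ∀ {A a h} → A ≐ SubStar a → (fits : Fits a) → ShortersKnown fits →
                      ∀ i v → Shortens (a i) v → starValueOf (a [ i ]≔ v) ≡ h →
                      ReachesValue A h
  subStar-shortenTo A≐ fits known i v sh value≡ =
    let mv , B≐ = subStar-shortening A≐ fits sh in mv , subst (HasGrundy Sℓ _) value≡ (known sh B≐)

  subStar-reachesZero : ∀ {A a} → A ≐ SubStar a → (fits : Fits a) → ShortersKnown fits →
                        zeroLegs a ≡ 0 → oneLegs a < 2 → twoLegs a ≡ 0 →
                        ReachesValue A 0
  subStar-reachesZero {A} {a} A≐ fits known z₀ n₁<2 z₂ with <2⇒≡0⊎≡1 n₁<2
  ... | inj₁ z₁ = let mv , B≐ = subStar-clearCentre A≐ (noCountedLegs a z₀ z₁ z₂) in mv , ∅-grundy B≐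
  ... | inj₂ o₁ with count-pos oneMod3 a (subst (0 <_) (sym o₁) (s≤s z≤n))
  ...   | i , odd with oneMod3-split (a i) odd
  ...     | inj₁ unit =
    let mv , B≐ = subStar-clearUnitLeg A≐ fits unit (onlyUnitLeg a i unit z₀ o₁ z₂) in mv , ∅-grundy B≐
  ...     | inj₂ (v , a≡ , v≡) =
    let e₁ , e₂ = legCounts-[]≔ a i v (≡ᵇ⇒≡ _ 1 odd) v≡
    in subStar-shortenTo A≐ fits known i v (inj₂ a≡)
         (cong₂ starValue (suc-injective (trans (sym (count-decreases e₁)) o₁)) (trans (count-increases e₂) (cong suc z₂)))

  subStar-lowerValues : ∀ {A a} → A ≐ SubStar a → (fits : Fits a) → ShortersKnown fits →
                        ∀ h → h < starValueOf a → ReachesValue A h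
  subStar-lowerValues {A} {a} A≐ fits known h h< with lowerValuesCovered (zeroLegs a) (oneLegs a) (twoLegs a) h h<
  ... | clearStar t refl =
    let t₀ , t₂₁ = to T-∧ t
        t₂ , t₁ = to T-∧ t₂₁
    in subStar-reachesZero A≐ fits known (≡ᵇ⇒≡ _ 0 t₀) (<ᵇ⇒< _ 2 t₁) (≡ᵇ⇒≡ _ 0 t₂)
  ... | shortenOne₁ t e =
    let i , odd = count-pos oneMod3 a (<ᵇ⇒< 0 _ t)
        v , a≡ , v≡ = oneMod3-pred (a i) odd
        e₁ , e₂ = legCounts-[]≔ a i v (≡ᵇ⇒≡ _ 1 odd) v≡
    in subStar-shortenTo A≐ fits known i v (inj₁ a≡)
         (trans (cong₂ starValue (cong pred (sym (count-decreases e₁))) (count-unchanged e₂)) e)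
  ... | shortenTwo₁ t e =
    let i , even = count-pos twoMod3 a (<ᵇ⇒< 0 _ t)
        v , a≡ , v≡ = twoMod3-pred (a i) even
        e₁ , e₂ = legCounts-[]≔ a i v (≡ᵇ⇒≡ _ 2 even) v≡
    in subStar-shortenTo A≐ fits known i v (inj₁ a≡)
         (trans (cong₂ starValue (count-increases e₁) (cong pred (sym (count-decreases e₂)))) e)
  ... | shortenTwo₂ t e =
    let i , even = count-pos twoMod3 a (<ᵇ⇒< 0 _ t)
        v , a≡ , v≡ = twoMod3-pred² (a i) even
        e₁ , e₂ = legCounts-[]≔ a i v (≡ᵇ⇒≡ _ 2 even) v≡
    in subStar-shortenTo A≐ fits known i v (inj₂ a≡)
         (trans (cong₂ starValue (count-unchanged e₁) (cong pred (sym (count-decreases e₂)))) e)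
  ... | shortenZero₁ t e =
    let i , zero⁺ = count-pos zeroMod3⁺ a (<ᵇ⇒< 0 _ t)
        v , a≡ , v≡ = zeroMod3⁺-pred (a i) zero⁺
        e₁ , e₂ = legCounts-[]≔ a i v (zeroMod3⁺⇒ (a i) zero⁺) v≡
    in subStar-shortenTo A≐ fits known i v (inj₁ a≡)
         (trans (cong₂ starValue (count-unchanged e₁) (count-increases e₂)) e)
  ... | shortenZero₂ t e =
    let i , zero⁺ = count-pos zeroMod3⁺ a (<ᵇ⇒< 0 _ t)
        v , a≡ , v≡ = zeroMod3⁺-pred² (a i) zero⁺
        e₁ , e₂ = legCounts-[]≔ a i v (zeroMod3⁺⇒ (a i) zero⁺) v≡
    in subStar-shortenTo A≐ fits known i v (inj₂ a≡)
         (trans (cong₂ starValue (count-increases e₁) (count-unchanged e₂)) e)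

  subStar-grundy : ∀ a {A} → A ≐ SubStar a → Fits a → HasGrundy Sℓ A (starValueOf a)
  subStar-grundy = All.wfRec (On.wellFounded totalLength <-wellFounded) 0ℓ _ λ a rec {A} A≐ fits →
    let known : ShortersKnown fits
        known {i} {v} sh B≐ = rec (totalLength-shortens a i v sh) B≐ (fits-[]≔ fits i v (<⇒≤ (shortens⇒< sh)))
    in grundy (λ mv → subStar-optionValue fits known (subStarMove-option A≐ fits mv))
              (subStar-lowerValues A≐ fits known)

  star-grundy : GrundyValue Sℓ (starValueOf ℓ)
  star-grundy = subStar-grundy ℓ whole (λ _ → ≤-refl)
    where
      whole : full Sℓ ≐ SubStar ℓ
      whole centre = mk⇔ (λ _ → tt) (λ _ → tt)
      whole (node i j) = mk⇔ (λ _ → toℕ<n j) (λ _ → tt)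

count-+3 : ∀ {k} p (a : Vector ℕ k) i → (∀ m → p (m + 3) ≡ p m) → count p (updateAt a i (λ m → m + 3)) ≡ count p a
count-+3 p a i periodic = +-cancelʳ-≡ (indicator (p (a i))) _ _
  (trans (sumOf-updateAt _ a i (λ m → m + 3)) (cong (λ b → count p a + indicator b) (periodic (a i))))

starValueOf-+3 : ∀ {k} (a : Vector ℕ k) i → starValueOf (updateAt a i (λ m → m + 3)) ≡ starValueOf a
starValueOf-+3 a i = cong₂ starValue (count-+3 oneMod3 a i λ m → cong (_≡ᵇ 1) (mod3-+3 m))
                                     (count-+3 twoMod3 a i λ m → cong (_≡ᵇ 2) (mod3-+3 m))

starValueOf-snoc3 : ∀ {k} (a : Vector ℕ k) → starValueOf (snoc a 3) ≡ starValueOf a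
starValueOf-snoc3 a = cong₂ starValue (trans (sumOf-snoc _ a 3) (+-identityʳ _)) (trans (sumOf-snoc _ a 3) (+-identityʳ _))

open StarPositions using (star-grundy)

lemma2 : (k : ℕ) (ℓ : Fin k → ℕ) → (∀ i → 1 ≤ ℓ i) →
         ((i : Fin k) → SameGrundy (Star k ℓ) (Star k (updateAt ℓ i (λ m → m + 3))))
         × SameGrundy (Star k ℓ) (Star (suc k) (snoc ℓ 3))
-- The legs need not be nonempty: the value formula holds for all leg lengths.
lemma2 k ℓ _ =
  (λ i → starValueOf ℓ , star-grundy k ℓ ,
           subst (GrundyValue _) (starValueOf-+3 ℓ i) (star-grundy k (updateAt ℓ i (λ m → m + 3)))) ,
  (starValueOf ℓ , star-grundy k ℓ ,
     subst (GrundyValue _) (starValueOf-snoc3 ℓ) (star-grundy (suc k) (snoc ℓ 3)))
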